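{- Let $\mathbb{A}$ be a finite affine plane of odd order $p$, and consider the switching game on $\mathbb{A}$. Then every configuration with at least one lit bulb is reducible.
   Context: A finite affine plane of order $p$ has $p^2$ points and $p^2+p$ lines, each line contains $p$ points, each point lies on $p+1$ lines, any two points lie on exactly one line, and for each line $L$ and point $P$ not on $L$ there is a unique line through $P$ not meeting $L$ (parallel to $L$). The switching game: there is one light bulb at each point, each either on (lit) or off; there is one switch for each line, and flipping the switch of a line toggles the state of every bulb at a point of that line. A configuration is an assignment of on/off states to all bulbs. A configuration is reducible if some finite sequence of switch flips produces a configuration with strictly fewer lit bulbs than the initial one. -}

module Defs where

open import Data.Nat using (ℕ; zero; suc; _+_; _*_; _<_)
open import Data.Fin using (Fin)
open import Data.Bool using (Bool; true; false; not; _∧_; _xor_; if_then_else_)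
open import Data.List using (List; foldr)
open import Data.Product using (∃; _×_)
open import Relation.Binary.PropositionalEquality using (_≡_; _≢_)

count : {n : ℕ} → (Fin n → Bool) → ℕ
count {zero}  f = 0
count {suc n} f = (if f Fin.zero then 1 else 0) + count {n} (λ i → f (Fin.suc i))

anyF : {n : ℕ} → (Fin n → Bool) → Bool
anyF {zero}  f = false
anyF {suc n} f = f Fin.zero Data.Bool.∨ anyF {n} (λ i → f (Fin.suc i))

Incidence : ℕ → Set
Incidence p = Fin (p * p) → Fin (p * p + p) → Bool

Disjoint : (p : ℕ) → Incidence p → Fin (p * p + p) → Fin (p * p + p) → Bool
Disjoint p inc L M = not (anyF (λ x → inc x L ∧ inc x M))

record IsAffinePlane (p : ℕ) (inc : Incidence p) : Set where
  field
    line-size   : ∀ L → count (λ x → inc x L) ≡ p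
    point-deg   : ∀ x → count (λ L → inc x L) ≡ suc p
    two-points  : ∀ x y → x ≢ y → count (λ L → inc x L ∧ inc y L) ≡ 1
    parallel    : ∀ L x → inc x L ≡ false →
                  count (λ M → inc x M ∧ Disjoint p inc L M) ≡ 1

-- configurations of bulbs: true = lit
Config : ℕ → Set
Config p = Fin (p * p) → Bool

flip : (p : ℕ) → Incidence p → Fin (p * p + p) → Config p → Config p
flip p inc L c x = c x xor inc x L

flips : (p : ℕ) → Incidence p → List (Fin (p * p + p)) → Config p → Config p
flips p inc ls c = foldr (flip p inc) c ls

lit : (p : ℕ) → Config p → ℕ
lit p c = count c

Reducible : (p : ℕ) → Incidence p → Config p → Set
Reducible p inc c = ∃ λ ls → lit p (flips p inc ls c) < lit p c

-- Fix a lit bulb x and any line L.  Flip the p + 1 lines through x together with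
-- the parallel class of L.  A point y ≠ x lies on exactly one line through x and
-- on exactly one line of the parallel class, so it is toggled twice; the point x
-- is toggled (p + 1) + 1 times, an odd number because p is odd.  Hence exactly
-- the bulb at x changes, and it goes off.
module Submission where

open import Defs
open import Data.Nat using (ℕ; zero; suc; _+_; _*_; _%_; _≥_; s≤s; z≤n)
open import Data.Nat.Properties using (≤-reflexive; +-suc)
open import Data.Bool using (Bool; true; false; not; _∧_; _xor_; if_then_else_)
open import Data.Bool.Properties
  using (xor-assoc; xor-comm; xor-identityʳ; ∧-identityʳ; ∧-zeroʳ; ∧-idem; not-involutive)
open import Data.Fin using (Fin)
open import Data.Fin.Properties using (suc-injective)
open import Data.List using (List; []; _∷_; _++_; map; foldr)
open import Data.Product using (∃; _,_)
open import Function using (_∘_; id)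
open import Relation.Binary.PropositionalEquality
  using (_≡_; _≢_; refl; sym; trans; cong; cong₂; subst; module ≡-Reasoning)

isOdd : ℕ → Bool
isOdd zero    = false
isOdd (suc n) = not (isOdd n)

%2≡1⇒isOdd : ∀ n → n % 2 ≡ 1 → isOdd n ≡ true
%2≡1⇒isOdd (suc zero)    _ = refl
%2≡1⇒isOdd (suc (suc n)) e = trans (not-involutive (isOdd n)) (%2≡1⇒isOdd n e)

xor-isOdd : ∀ b n → b xor isOdd n ≡ isOdd ((if b then 1 else 0) + n)
xor-isOdd true  n = refl
xor-isOdd false n = refl

count-cong : ∀ {n} {f g : Fin n → Bool} → (∀ i → f i ≡ g i) → count f ≡ count g
count-cong {zero}        e = refl
count-cong {suc n} {f} e rewrite e Fin.zero = cong (_ +_) (count-cong (e ∘ Fin.suc))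

count-none : ∀ {n} {f : Fin n → Bool} → (∀ i → f i ≡ false) → count f ≡ 0
count-none {zero}        e = refl
count-none {suc n} {f} e rewrite e Fin.zero = count-none (e ∘ Fin.suc)

count-remove : ∀ {n} {f g : Fin n → Bool} x → f x ≡ true → g x ≡ false →
               (∀ y → y ≢ x → g y ≡ f y) → count f ≡ suc (count g)
count-remove Fin.zero fx gx agree rewrite fx | gx =
  cong suc (count-cong (λ i → sym (agree (Fin.suc i) (λ ()))))
count-remove {suc n} {f} {g} (Fin.suc x) fx gx agree rewrite agree Fin.zero (λ ()) =
  trans (cong ((if f Fin.zero then 1 else 0) +_) (count-remove x fx gx agree-suc))
        (+-suc _ _)
  where
  agree-suc : ∀ y → y ≢ x → g (Fin.suc y) ≡ f (Fin.suc y)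
  agree-suc y y≢x = agree (Fin.suc y) (y≢x ∘ suc-injective)

count≥1⇒witness : ∀ {n} {f : Fin n → Bool} → count f ≥ 1 → ∃ λ x → f x ≡ true
count≥1⇒witness {suc n} {f} h with f Fin.zero in fz
... | true  = Fin.zero , fz
... | false with count≥1⇒witness {f = f ∘ Fin.suc} h
...   | x , fx = Fin.suc x , fx

anyF-intro : ∀ {n} (f : Fin n → Bool) x → f x ≡ true → anyF f ≡ true
anyF-intro f Fin.zero     fx rewrite fx = refl
anyF-intro f (Fin.suc x)  fx with f Fin.zero
... | true  = refl
... | false = anyF-intro (f ∘ Fin.suc) x fx

parityOn : ∀ {m} → (Fin m → Bool) → List (Fin m) → Bool
parityOn h = foldr (λ L b → h L xor b) false

parityOn-++ : ∀ {m} (h : Fin m → Bool) ls ms →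
              parityOn h (ls ++ ms) ≡ parityOn h ls xor parityOn h ms
parityOn-++ h []       ms = refl
parityOn-++ h (L ∷ ls) ms =
  trans (cong (h L xor_) (parityOn-++ h ls ms)) (sym (xor-assoc (h L) _ _))

parityOn-map : ∀ {m k} (h : Fin m → Bool) (g : Fin k → Fin m) ls →
               parityOn h (map g ls) ≡ parityOn (h ∘ g) ls
parityOn-map h g []       = refl
parityOn-map h g (L ∷ ls) = cong (h (g L) xor_) (parityOn-map h g ls)

select : ∀ {m} → (Fin m → Bool) → List (Fin m)
select {zero}  f = []
select {suc m} f =
  (if f Fin.zero then Fin.zero ∷_ else id) (map Fin.suc (select (f ∘ Fin.suc)))

parityOn-select : ∀ {m} (h f : Fin m → Bool) →
                  parityOn h (select f) ≡ isOdd (count (λ i → h i ∧ f i))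
parityOn-select-suc : ∀ {m} (h f : Fin (suc m) → Bool) →
                      parityOn h (map Fin.suc (select (f ∘ Fin.suc)))
                        ≡ isOdd (count (λ i → h (Fin.suc i) ∧ f (Fin.suc i)))

parityOn-select {zero}  h f = refl
parityOn-select {suc m} h f with f Fin.zero
... | true  rewrite ∧-identityʳ (h Fin.zero) =
  trans (cong (h Fin.zero xor_) (parityOn-select-suc h f)) (xor-isOdd (h Fin.zero) _)
... | false rewrite ∧-zeroʳ (h Fin.zero) = parityOn-select-suc h f

parityOn-select-suc h f = trans (parityOn-map h Fin.suc (select (f ∘ Fin.suc)))
                                (parityOn-select (h ∘ Fin.suc) (f ∘ Fin.suc))

flips-at : ∀ p inc ls (c : Config p) y → flips p inc ls c y ≡ c y xor parityOn (inc y) ls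
flips-at p inc []       c y = sym (xor-identityʳ (c y))
flips-at p inc (L ∷ ls) c y = begin
  flips p inc ls c y xor inc y L              ≡⟨ cong (_xor inc y L) (flips-at p inc ls c y) ⟩
  (c y xor parityOn (inc y) ls) xor inc y L   ≡⟨ xor-assoc (c y) _ _ ⟩
  c y xor (parityOn (inc y) ls xor inc y L)   ≡⟨ cong (c y xor_) (xor-comm (parityOn (inc y) ls) _) ⟩
  c y xor parityOn (inc y) (L ∷ ls)           ∎
  where open ≡-Reasoning

common-point⇒¬Disjoint : ∀ p (inc : Incidence p) {L M} y →
                          inc y L ≡ true → inc y M ≡ true → Disjoint p inc L M ≡ false
common-point⇒¬Disjoint p inc {L} {M} y yL yM
  rewrite anyF-intro (λ z → inc z L ∧ inc z M) y (subst (λ b → b ∧ inc y M ≡ true) (sym yL) yM)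
  = refl

module AffinePlane {p : ℕ} {inc : Incidence p} (A : IsAffinePlane p inc) where
  open IsAffinePlane A

  line-through : ∀ x → ∃ λ L → inc x L ≡ true
  line-through x = count≥1⇒witness (subst (_≥ 1) (sym (point-deg x)) (s≤s z≤n))

  pencil : Fin (p * p) → List (Fin (p * p + p))
  pencil x = select (inc x)

  pencil-centre : ∀ x → parityOn (inc x) (pencil x) ≡ isOdd (suc p)
  pencil-centre x = trans (parityOn-select (inc x) (inc x))
                          (cong isOdd (trans (count-cong (λ L → ∧-idem (inc x L))) (point-deg x)))

  pencil-elsewhere : ∀ {x y} → y ≢ x → parityOn (inc y) (pencil x) ≡ true
  pencil-elsewhere {x} {y} y≢x =
    trans (parityOn-select (inc y) (inc x)) (cong isOdd (two-points y x y≢x))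

  parallelClass : Fin (p * p + p) → List (Fin (p * p + p))
  parallelClass L = L ∷ select (Disjoint p inc L)

  parallelClass-covers : ∀ L y → parityOn (inc y) (parallelClass L) ≡ true
  parallelClass-covers L y with inc y L in yL
  ... | false = trans (parityOn-select (inc y) _) (cong isOdd (parallel L y yL))
  ... | true  = cong not (trans (parityOn-select (inc y) _) (cong isOdd (count-none none)))
    where
    none : ∀ M → (inc y M ∧ Disjoint p inc L M) ≡ false
    none M with inc y M in yM
    ... | false = refl
    ... | true  = common-point⇒¬Disjoint p inc y yL yM

  toggle : Fin (p * p) → Fin (p * p + p) → List (Fin (p * p + p))
  toggle x L = pencil x ++ parallelClass L

  flips-toggle : ∀ x L (c : Config p) y →
                 flips p inc (toggle x L) c y
                   ≡ c y xor (parityOn (inc y) (pencil x) xor parityOn (inc y) (parallelClass L))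
  flips-toggle x L c y =
    trans (flips-at p inc (toggle x L) c y) (cong (c y xor_) (parityOn-++ (inc y) (pencil x) _))

  toggle-centre : isOdd p ≡ true → ∀ x L (c : Config p) → flips p inc (toggle x L) c x ≡ not (c x)
  toggle-centre p-odd x L c = begin
    flips p inc (toggle x L) c x  ≡⟨ flips-toggle x L c x ⟩
    c x xor (parityOn (inc x) (pencil x) xor parityOn (inc x) (parallelClass L))
      ≡⟨ cong (c x xor_) (cong₂ _xor_ (trans (pencil-centre x) (cong not p-odd)) (parallelClass-covers L x)) ⟩
    c x xor true                  ≡⟨ xor-comm (c x) true ⟩
    not (c x)                     ∎
    where open ≡-Reasoning

  toggle-elsewhere : ∀ {x y} L (c : Config p) → y ≢ x → flips p inc (toggle x L) c y ≡ c y
  toggle-elsewhere {x} {y} L c y≢x = begin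
    flips p inc (toggle x L) c y  ≡⟨ flips-toggle x L c y ⟩
    c y xor (parityOn (inc y) (pencil x) xor parityOn (inc y) (parallelClass L))
      ≡⟨ cong (c y xor_) (cong₂ _xor_ (pencil-elsewhere y≢x) (parallelClass-covers L y)) ⟩
    c y xor false                 ≡⟨ xor-identityʳ (c y) ⟩
    c y                           ∎
    where open ≡-Reasoning

open AffinePlane

theorem4 : (p : ℕ) → p % 2 ≡ 1 → (inc : Incidence p) → IsAffinePlane p inc →
           (c : Config p) → lit p c ≥ 1 → Reducible p inc c
theorem4 p p%2≡1 inc A c c-lit with count≥1⇒witness c-lit
... | x , cx with line-through A x
...   | L , _ = toggle A x L , ≤-reflexive (sym (count-remove x cx x-off others-unchanged))
  where
  x-off : flips p inc (toggle A x L) c x ≡ false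
  x-off = trans (toggle-centre A (%2≡1⇒isOdd p p%2≡1) x L c) (cong not cx)
  others-unchanged : ∀ y → y ≢ x → flips p inc (toggle A x L) c y ≡ c y
  others-unchanged y = toggle-elsewhere A L c
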